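{- Let $\mathcal{M}=(V,\mathcal{I})$ be a matroid, let $\ell\ge 1$ be an integer, and let $f:2^V\to\mathbb{R}_+$ be a monotone submodular function with $f(\emptyset)=0$. Consider the extended greedy algorithm: for $\tau=1,\dots,\ell$, set $S_\tau\gets\emptyset$ and, while $S_\tau$ is not a basis of $\mathcal{M}$, compute $e^*\in\arg\max\{ f(S_1\cup\dots\cup S_\tau\cup\{e\}) : e\in V\setminus S_\tau,\ S_\tau\cup\{e\}\in\mathcal{I}\}$ and update $S_\tau\gets S_\tau\cup\{e^*\}$. Then the returned sets $S_1,\dots,S_\ell\in\mathcal{I}$ satisfy \[f\left(S_1\cup\dots\cup S_\ell\right)\geq \left(1-\frac{1}{2^\ell}\right) \max_{S\in \mathcal{I}} f(S).\]
   Context: A set function $f$ is submodular if $f(A\cup\{e\})-f(A)\ge f(B\cup\{e\})-f(B)$ for all $A\subseteq B\subseteq V\setminus\{e\}$, and monotone if $f(A)\le f(B)$ whenever $A\subseteq B$. A basis of a matroid is a maximal independent set. -}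

module Defs where

open import Level using (0ℓ)
open import Data.Nat using (ℕ; zero; suc)
open import Data.Fin using (Fin)
open import Data.Fin.Subset using (Subset; _∈_; _∉_; _⊆_; _∪_; ⁅_⁆; ∣_∣) renaming (⊥ to ∅)
open import Data.Vec using (Vec; []; _∷_)
open import Data.Product using (Σ; _×_; ∃-syntax)
open import Relation.Binary.Structures using (IsTotalOrder)
open import Algebra.Bundles using (CommutativeRing)

-- Values: an ordered commutative ring (ℝ is an instance).  Stdlib has no
-- real numbers, so the theorem is stated for every ordered commutative ring.

record OrderedCommRing : Set₁ where
  field
    commRing : CommutativeRing 0ℓ 0ℓ
  open CommutativeRing commRing public
  field
    _≤_          : Carrier → Carrier → Set
    isTotalOrder : IsTotalOrder _≈_ _≤_
    +-mono-≤     : ∀ {x y} z → x ≤ y → (x + z) ≤ (y + z)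
    *-nonneg     : ∀ {x y} → 0# ≤ x → 0# ≤ y → 0# ≤ (x * y)

  fromℕ : ℕ → Carrier
  fromℕ zero    = 0#
  fromℕ (suc k) = 1# + fromℕ k

record Matroid (n : ℕ) : Set₁ where
  field
    Indep      : Subset n → Set
    indep-∅    : Indep ∅
    indep-down : ∀ {A B} → A ⊆ B → Indep B → Indep A
    exchange   : ∀ {A B} → Indep A → Indep B → Data.Nat._<_ ∣ A ∣ ∣ B ∣ →
                 ∃[ e ] (e ∈ B × e ∉ A × Indep (A ∪ ⁅ e ⁆))

  IsBasis : Subset n → Set
  IsBasis S = Indep S × (∀ B → S ⊆ B → Indep B → B ⊆ S)

module _ (R : OrderedCommRing) {n : ℕ} where
  open OrderedCommRing R using (Carrier; _≤_; _-_)

  Monotone : (Subset n → Carrier) → Set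
  Monotone f = ∀ {A B} → A ⊆ B → f A ≤ f B

  Submodular : (Subset n → Carrier) → Set
  Submodular f = ∀ {A B e} → A ⊆ B → e ∉ B →
    (f (B ∪ ⁅ e ⁆) - f B) ≤ (f (A ∪ ⁅ e ⁆) - f A)

-- Executions of the extended greedy algorithm (any tie-breaking).

module Greedy (R : OrderedCommRing) {n : ℕ} (M : Matroid n)
              (f : Subset n → OrderedCommRing.Carrier R) where
  open OrderedCommRing R using (Carrier; _≤_; _-_)
  open Matroid M

  -- PhaseReach T S : within a phase whose earlier sets have union T,
  -- the current set S_τ = S can be reached from ∅ by greedy steps.
  -- A step adds an argmax of f(T ∪ S_τ ∪ {e}) over e ∉ S_τ with S_τ ∪ {e} ∈ I
  -- (such an e exists exactly when S_τ is not a basis).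
  data PhaseReach (T : Subset n) : Subset n → Set where
    start : PhaseReach T ∅
    step  : ∀ {S} e → PhaseReach T S → e ∉ S → Indep (S ∪ ⁅ e ⁆) →
            (∀ e′ → e′ ∉ S → Indep (S ∪ ⁅ e′ ⁆) →
               f ((T ∪ S) ∪ ⁅ e′ ⁆) ≤ f ((T ∪ S) ∪ ⁅ e ⁆)) →
            PhaseReach T (S ∪ ⁅ e ⁆)

  PhaseOutput : Subset n → Subset n → Set
  PhaseOutput T S = PhaseReach T S × IsBasis S

  ⋃ : ∀ {k} → Vec (Subset n) k → Subset n
  ⋃ []       = ∅
  ⋃ (S ∷ Ss) = S ∪ ⋃ Ss

  -- Run k Ss : Ss = S_k ∷ … ∷ S_1 are the sets returned after k phases
  -- (most recent first).
  data Run : (k : ℕ) → Vec (Subset n) k → Set where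
    run-zero : Run zero []
    run-suc  : ∀ {k Ss S} → Run k Ss → PhaseOutput (⋃ Ss) S → Run (suc k) (S ∷ Ss)

module Submission where

-- One greedy phase, run on top of the union T of the earlier phases, returns a basis S with
-- f(O) + f(T) ≤ 2 f(T ∪ S) for every independent O.  The invariant is propagated backwards along
-- the phase: c bounds f(T ∪ Y) + f(T ∪ S) for all independent Y ⊇ S, starting from c = 2 f(T ∪ S)
-- at the basis.  Across a greedy step S ↦ S ∪ {e}, augmentation gives an independent A ⊇ S ∪ {e}
-- inside Y ∪ {e} with |A| ≥ |Y|, so A misses at most one element o of Y; submodularity and the
-- greedy preference of e over o then transfer the bound from A to Y.  With a_k the value after
-- k phases this reads f(O) + a_k ≤ 2 a_{k+1}, and (2^k − 1) f(O) ≤ 2^k a_k follows by induction.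

open import Defs
open import Data.Nat using (ℕ; zero; suc; _≥_)
import Data.Nat as ℕ
import Data.Nat.Properties as ℕ
open import Data.Fin using (Fin)
open import Data.Fin.Properties using (any?) renaming (_≟_ to _≟ᶠ_)
open import Data.Fin.Subset using (Subset; _∈_; _∉_; _⊆_; _∪_; ⁅_⁆; ∣_∣; inside; outside)
  renaming (⊥ to ∅)
open import Data.Fin.Subset.Properties
  using (_∈?_; ⊥⊆; ∪-comm; p⊆p∪q; q⊆p∪q; x∈p∪q⁻; x∈⁅x⁆; x∈⁅y⁆⇒x≡y;
         ∣⁅x⁆∣≡1; p⊆q⇒∣p∣≤∣q∣; p⊂q⇒∣p∣<∣q∣; x∈p∧x≢y⇒x∈p-y; x∈p⇒∣p-x∣<∣p∣)
open import Data.Vec using (Vec; []; _∷_)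
open import Data.Vec.Relation.Unary.All using (All; []; _∷_)
open import Data.Product using (_×_; _,_; proj₁; proj₂; ∃-syntax)
open import Function using (_∘_; id)
open import Data.Sum using (_⊎_; inj₁; inj₂)
open import Relation.Binary.Bundles using (TotalOrder)
open import Relation.Binary.PropositionalEquality using (_≡_; _≢_; refl; cong) renaming (sym to ≡-sym)
open import Relation.Nullary using (yes; no; contradiction)
open import Relation.Nullary.Decidable using (_×-dec_; ¬?)
import Relation.Binary.Reasoning.PartialOrder as PartialOrderReasoning
import Relation.Binary.Reasoning.Setoid as SetoidReasoning

module OrderedCommRingProperties (R : OrderedCommRing) where
  open OrderedCommRing R

  totalOrder : TotalOrder _ _ _
  totalOrder = record { isTotalOrder = isTotalOrder }

  open TotalOrder totalOrder public
    using (poset) renaming (reflexive to ≤-reflexive; trans to ≤-trans)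

  module ≤-Reasoning = PartialOrderReasoning poset

  +-monoʳ-≤ : ∀ {x y} z → x ≤ y → (z + x) ≤ (z + y)
  +-monoʳ-≤ {x} {y} z x≤y = begin
    z + x ≈⟨ +-comm z x ⟩
    x + z ≤⟨ +-mono-≤ z x≤y ⟩
    y + z ≈⟨ +-comm y z ⟩
    z + y ∎
    where open ≤-Reasoning

  +-mono₂-≤ : ∀ {a b c d} → a ≤ b → c ≤ d → (a + c) ≤ (b + d)
  +-mono₂-≤ {b = b} {c} a≤b c≤d = ≤-trans (+-mono-≤ c a≤b) (+-monoʳ-≤ b c≤d)

  x-y+[y+z]≈x+z : ∀ x y z → ((x - y) + (y + z)) ≈ (x + z)
  x-y+[y+z]≈x+z x y z = begin
    (x - y) + (y + z)   ≈⟨ +-assoc x (- y) (y + z) ⟩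
    x + (- y + (y + z)) ≈⟨ +-congˡ (sym (+-assoc (- y) y z)) ⟩
    x + ((- y + y) + z) ≈⟨ +-congˡ (+-congʳ (-‿inverseˡ y)) ⟩
    x + (0# + z)        ≈⟨ +-congˡ (+-identityˡ z) ⟩
    x + z               ∎
    where open SetoidReasoning setoid

  x-y≤z-w⇒x+w≤z+y : ∀ {x y z w} → (x - y) ≤ (z - w) → (x + w) ≤ (z + y)
  x-y≤z-w⇒x+w≤z+y {x} {y} {z} {w} x-y≤z-w = begin
    x + w             ≈⟨ sym (x-y+[y+z]≈x+z x y w) ⟩
    (x - y) + (y + w) ≤⟨ +-mono-≤ (y + w) x-y≤z-w ⟩
    (z - w) + (y + w) ≈⟨ +-congˡ (+-comm y w) ⟩
    (z - w) + (w + y) ≈⟨ x-y+[y+z]≈x+z z w y ⟩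
    z + y             ∎
    where open ≤-Reasoning

  fromℕ-+ : ∀ m k → fromℕ (m ℕ.+ k) ≈ (fromℕ m + fromℕ k)
  fromℕ-+ zero    k = sym (+-identityˡ (fromℕ k))
  fromℕ-+ (suc m) k = trans (+-congˡ (fromℕ-+ m k)) (sym (+-assoc 1# (fromℕ m) (fromℕ k)))

  fromℕ-2* : ∀ m → fromℕ (2 ℕ.* m) ≈ (fromℕ m + fromℕ m)
  fromℕ-2* m = trans (fromℕ-+ m (m ℕ.+ 0)) (+-congˡ (reflexive (cong fromℕ (ℕ.+-identityʳ m))))

  fromℕ-suc-* : ∀ m x → (fromℕ (suc m) * x) ≈ (x + fromℕ m * x)
  fromℕ-suc-* m x = trans (distribʳ x 1# (fromℕ m)) (+-congʳ (*-identityˡ x))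

  fromℕ-*-monoʳ-≤ : ∀ m {x y} → x ≤ y → (fromℕ m * x) ≤ (fromℕ m * y)
  fromℕ-*-monoʳ-≤ zero    {x} {y} _   = ≤-reflexive (trans (zeroˡ x) (sym (zeroˡ y)))
  fromℕ-*-monoʳ-≤ (suc m) {x} {y} x≤y = begin
    fromℕ (suc m) * x ≈⟨ fromℕ-suc-* m x ⟩
    x + fromℕ m * x   ≤⟨ +-mono₂-≤ x≤y (fromℕ-*-monoʳ-≤ m x≤y) ⟩
    y + fromℕ m * y   ≈⟨ fromℕ-suc-* m y ⟨
    fromℕ (suc m) * y ∎
    where open ≤-Reasoning

  -- The approximation ratio 1 − 1/m with the denominator cleared: (1 − 1/m) opt ≤ val.
  Approx : ℕ → Carrier → Carrier → Set
  Approx m opt val = ((fromℕ m - 1#) * opt) ≤ (fromℕ m * val)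

  approx-1 : ∀ {opt val} → 0# ≤ val → Approx 1 opt val
  approx-1 {opt} {val} 0≤val = begin
    ((1# + 0#) - 1#) * opt ≈⟨ *-congʳ (+-congʳ (+-identityʳ 1#)) ⟩
    (1# - 1#) * opt        ≈⟨ *-congʳ (-‿inverseʳ 1#) ⟩
    0# * opt               ≈⟨ zeroˡ opt ⟩
    0#                     ≤⟨ 0≤val ⟩
    val                    ≈⟨ *-identityˡ val ⟨
    1# * val               ≈⟨ *-congʳ (+-identityʳ 1#) ⟨
    (1# + 0#) * val        ∎
    where open ≤-Reasoning

  approx-2* : ∀ m {opt val val′} → Approx m opt val → (opt + val) ≤ (val′ + val′) →
              Approx (2 ℕ.* m) opt val′
  approx-2* m {opt} {val} {val′} approx opt+val≤2val′ = begin
    (fromℕ (2 ℕ.* m) - 1#) * opt ≈⟨ *-congʳ (+-congʳ (fromℕ-2* m)) ⟩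
    ((q + q) - 1#) * opt         ≈⟨ *-congʳ (trans (+-assoc q q (- 1#)) (+-comm q (q - 1#))) ⟩
    ((q - 1#) + q) * opt         ≈⟨ distribʳ opt (q - 1#) q ⟩
    (q - 1#) * opt + q * opt     ≤⟨ +-mono-≤ (q * opt) approx ⟩
    q * val + q * opt            ≈⟨ trans (+-comm (q * val) (q * opt)) (sym (distribˡ q opt val)) ⟩
    q * (opt + val)              ≤⟨ fromℕ-*-monoʳ-≤ m opt+val≤2val′ ⟩
    q * (val′ + val′)            ≈⟨ trans (distribˡ q val′ val′) (sym (distribʳ val′ q q)) ⟩
    (q + q) * val′               ≈⟨ *-congʳ (fromℕ-2* m) ⟨
    fromℕ (2 ℕ.* m) * val′       ∎
    where
    q = fromℕ m
    open ≤-Reasoning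

∣p∪q∣≤∣p∣+∣q∣ : ∀ {n} (p q : Subset n) → ∣ p ∪ q ∣ ℕ.≤ ∣ p ∣ ℕ.+ ∣ q ∣
∣p∪q∣≤∣p∣+∣q∣ []            []            = ℕ.z≤n
∣p∪q∣≤∣p∣+∣q∣ (outside ∷ p) (outside ∷ q) = ∣p∪q∣≤∣p∣+∣q∣ p q
∣p∪q∣≤∣p∣+∣q∣ (outside ∷ p) (inside ∷ q)  =
  ℕ.≤-trans (ℕ.s≤s (∣p∪q∣≤∣p∣+∣q∣ p q)) (ℕ.≤-reflexive (≡-sym (ℕ.+-suc ∣ p ∣ ∣ q ∣)))
∣p∪q∣≤∣p∣+∣q∣ (inside ∷ p)  (outside ∷ q) = ℕ.s≤s (∣p∪q∣≤∣p∣+∣q∣ p q)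
∣p∪q∣≤∣p∣+∣q∣ (inside ∷ p)  (inside ∷ q)  =
  ℕ.s≤s (ℕ.≤-trans (∣p∪q∣≤∣p∣+∣q∣ p q) (ℕ.+-monoʳ-≤ ∣ p ∣ (ℕ.n≤1+n ∣ q ∣)))

module _ {n : ℕ} where
  open import Data.Fin.Subset using (_-_)

  ∪-least : {A B C : Subset n} → A ⊆ C → B ⊆ C → A ∪ B ⊆ C
  ∪-least {A} {B} A⊆C B⊆C x∈A∪B with x∈p∪q⁻ A B x∈A∪B
  ... | inj₁ x∈A = A⊆C x∈A
  ... | inj₂ x∈B = B⊆C x∈B

  ∪-mono : {A B C D : Subset n} → A ⊆ C → B ⊆ D → A ∪ B ⊆ C ∪ D
  ∪-mono {C = C} {D} A⊆C B⊆D = ∪-least (λ x∈A → p⊆p∪q D (A⊆C x∈A)) (λ x∈B → q⊆p∪q C D (B⊆D x∈B))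

  ∪-inl : {A B : Subset n} → A ⊆ A ∪ B
  ∪-inl {B = B} = p⊆p∪q B

  ∪-inr : {A B : Subset n} → B ⊆ A ∪ B
  ∪-inr {A} {B} = q⊆p∪q A B

  x∈p⇒⁅x⁆⊆p : {x : Fin n} {p : Subset n} → x ∈ p → ⁅ x ⁆ ⊆ p
  x∈p⇒⁅x⁆⊆p {x} x∈p y∈⁅x⁆ with x∈⁅y⁆⇒x≡y x y∈⁅x⁆
  ... | refl = x∈p

  two-missing⇒∣∣< : ∀ {A Y : Subset n} {e x o} → A ⊆ Y ∪ ⁅ e ⁆ → x ∈ Y → o ∈ Y → x ≢ o →
                    x ∉ A → o ∉ A → ∣ A ∣ ℕ.< ∣ Y ∣
  two-missing⇒∣∣< {A} {Y} {e} {x} {o} A⊆Y∪e x∈Y o∈Y x≢o x∉A o∉A = begin-strict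
    ∣ A ∣               ≤⟨ p⊆q⇒∣p∣≤∣q∣ A⊆Z∪e ⟩
    ∣ Z ∪ ⁅ e ⁆ ∣       ≤⟨ ∣p∪q∣≤∣p∣+∣q∣ Z ⁅ e ⁆ ⟩
    ∣ Z ∣ ℕ.+ ∣ ⁅ e ⁆ ∣ ≡⟨ cong (∣ Z ∣ ℕ.+_) (∣⁅x⁆∣≡1 e) ⟩
    ∣ Z ∣ ℕ.+ 1         ≡⟨ ℕ.+-comm ∣ Z ∣ 1 ⟩
    suc ∣ Z ∣           ≤⟨ x∈p⇒∣p-x∣<∣p∣ (x∈p∧x≢y⇒x∈p-y x∈Y x≢o) ⟩
    ∣ Y - o ∣           <⟨ x∈p⇒∣p-x∣<∣p∣ o∈Y ⟩
    ∣ Y ∣               ∎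
    where
    open ℕ.≤-Reasoning
    Z = Y - o - x
    A⊆Z∪e : A ⊆ Z ∪ ⁅ e ⁆
    A⊆Z∪e {z} z∈A with x∈p∪q⁻ Y ⁅ e ⁆ (A⊆Y∪e z∈A)
    ... | inj₁ z∈Y = ∪-inl (x∈p∧x≢y⇒x∈p-y (x∈p∧x≢y⇒x∈p-y z∈Y λ { refl → o∉A z∈A })
                                           λ { refl → x∉A z∈A })
    ... | inj₂ z∈⁅e⁆ = ∪-inr z∈⁅e⁆

  misses-at-most-one : ∀ {A Y : Subset n} e → A ⊆ Y ∪ ⁅ e ⁆ → ∣ Y ∣ ℕ.≤ ∣ A ∣ →
                       Y ⊆ A ⊎ ∃[ o ] (o ∈ Y × Y ⊆ A ∪ ⁅ o ⁆)
  misses-at-most-one {A} {Y} e A⊆Y∪e ∣Y∣≤∣A∣ with any? (λ o → (o ∈? Y) ×-dec ¬? (o ∈? A))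
  ... | no nothing-missing = inj₁ Y⊆A
    where
    Y⊆A : Y ⊆ A
    Y⊆A {x} x∈Y with x ∈? A
    ... | yes x∈A = x∈A
    ... | no x∉A  = contradiction (x , x∈Y , x∉A) nothing-missing
  ... | yes (o , o∈Y , o∉A) = inj₂ (o , o∈Y , Y⊆A∪o)
    where
    Y⊆A∪o : Y ⊆ A ∪ ⁅ o ⁆
    Y⊆A∪o {x} x∈Y with x ∈? A | x ≟ᶠ o
    ... | yes x∈A | _        = ∪-inl x∈A
    ... | no _    | yes refl = ∪-inr (x∈⁅x⁆ o)
    ... | no x∉A  | no x≢o   =
      contradiction ∣Y∣≤∣A∣ (ℕ.<⇒≱ (two-missing⇒∣∣< A⊆Y∪e x∈Y o∈Y x≢o x∉A o∉A))

module MatroidProperties {n : ℕ} (M : Matroid n) where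
  open Matroid M

  augment : ∀ {A Y} → Indep A → Indep Y →
            ∃[ A′ ] (A ⊆ A′ × A′ ⊆ A ∪ Y × Indep A′ × ∣ Y ∣ ℕ.≤ ∣ A′ ∣)
  augment {A} {Y} iA iY = go ∣ Y ∣ iA (ℕ.m≤m+n ∣ Y ∣ ∣ A ∣)
    where
    grow : ∀ fuel {A x} → x ∉ A → ∣ Y ∣ ℕ.≤ suc fuel ℕ.+ ∣ A ∣ → ∣ Y ∣ ℕ.≤ fuel ℕ.+ ∣ A ∪ ⁅ x ⁆ ∣
    grow fuel {A} {x} x∉A ∣Y∣≤ = ℕ.≤-trans ∣Y∣≤ (ℕ.≤-trans (ℕ.≤-reflexive (≡-sym (ℕ.+-suc fuel ∣ A ∣)))
      (ℕ.+-monoʳ-≤ fuel (p⊂q⇒∣p∣<∣q∣ (∪-inl , x , ∪-inr (x∈⁅x⁆ x) , x∉A))))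

    go : ∀ fuel {A} → Indep A → ∣ Y ∣ ℕ.≤ fuel ℕ.+ ∣ A ∣ →
         ∃[ A′ ] (A ⊆ A′ × A′ ⊆ A ∪ Y × Indep A′ × ∣ Y ∣ ℕ.≤ ∣ A′ ∣)
    go zero {A} iA ∣Y∣≤∣A∣ = A , id , ∪-inl , iA , ∣Y∣≤∣A∣
    go (suc fuel) {A} iA ∣Y∣≤ with ∣ Y ∣ ℕ.≤? ∣ A ∣
    ... | yes ∣Y∣≤∣A∣ = A , id , ∪-inl , iA , ∣Y∣≤∣A∣
    ... | no ∣Y∣≰∣A∣ with exchange iA iY (ℕ.≰⇒> ∣Y∣≰∣A∣)
    ...   | x , x∈Y , x∉A , iA∪x with go fuel iA∪x (grow fuel x∉A ∣Y∣≤)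
    ...     | A′ , A∪x⊆A′ , A′⊆A∪x∪Y , iA′ , ∣Y∣≤∣A′∣ =
      A′ , (λ a → A∪x⊆A′ (∪-inl a)) ,
      (λ a → ∪-least (∪-least ∪-inl (x∈p⇒⁅x⁆⊆p (∪-inr x∈Y))) ∪-inr (A′⊆A∪x∪Y a)) ,
      iA′ , ∣Y∣≤∣A′∣

module GreedyPhase (R : OrderedCommRing) {n : ℕ} (M : Matroid n)
                   (f : Subset n → OrderedCommRing.Carrier R)
                   (mono : Monotone R f) (submod : Submodular R f) (T : Subset n) where
  open OrderedCommRing R
  open OrderedCommRingProperties R
  open Matroid M
  open MatroidProperties M
  open Greedy R M f

  GreedyChoice : Subset n → Fin n → Set
  GreedyChoice S e = ∀ e′ → e′ ∉ S → Indep (S ∪ ⁅ e′ ⁆) → f ((T ∪ S) ∪ ⁅ e′ ⁆) ≤ f ((T ∪ S) ∪ ⁅ e ⁆)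

  ExtensionBound : Carrier → Subset n → Set
  ExtensionBound c S = ∀ Y → S ⊆ Y → Indep Y → (f (T ∪ Y) + f (T ∪ S)) ≤ c

  swap-inequality-covered : ∀ {S A Y e} → Y ⊆ T ∪ A →
                            (f (T ∪ Y) + f (T ∪ S)) ≤ (f (T ∪ A) + f (T ∪ (S ∪ ⁅ e ⁆)))
  swap-inequality-covered Y⊆T∪A = +-mono₂-≤ (mono (∪-least ∪-inl Y⊆T∪A)) (mono (∪-mono id ∪-inl))

  swap-inequality-single : ∀ {S A Y e o} → S ⊆ A → o ∉ T ∪ A → Y ⊆ A ∪ ⁅ o ⁆ →
                           f ((T ∪ S) ∪ ⁅ o ⁆) ≤ f ((T ∪ S) ∪ ⁅ e ⁆) →
                           (f (T ∪ Y) + f (T ∪ S)) ≤ (f (T ∪ A) + f (T ∪ (S ∪ ⁅ e ⁆)))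
  swap-inequality-single {S} {A} {Y} {e} {o} S⊆A o∉T∪A Y⊆A∪o e-beats-o = begin
    f (T ∪ Y) + f (T ∪ S)           ≤⟨ +-mono-≤ _ (mono T∪Y⊆T∪A∪o) ⟩
    f ((T ∪ A) ∪ ⁅ o ⁆) + f (T ∪ S) ≤⟨ x-y≤z-w⇒x+w≤z+y (submod (∪-mono id S⊆A) o∉T∪A) ⟩
    f ((T ∪ S) ∪ ⁅ o ⁆) + f (T ∪ A) ≤⟨ +-mono-≤ _ (≤-trans e-beats-o (mono T∪S∪e⊆T∪[S∪e])) ⟩
    f (T ∪ (S ∪ ⁅ e ⁆)) + f (T ∪ A) ≈⟨ +-comm _ _ ⟩
    f (T ∪ A) + f (T ∪ (S ∪ ⁅ e ⁆)) ∎
    where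
    open ≤-Reasoning
    T∪Y⊆T∪A∪o : T ∪ Y ⊆ (T ∪ A) ∪ ⁅ o ⁆
    T∪Y⊆T∪A∪o = ∪-least (∪-inl ∘ ∪-inl) (∪-mono ∪-inr id ∘ Y⊆A∪o)
    T∪S∪e⊆T∪[S∪e] : (T ∪ S) ∪ ⁅ e ⁆ ⊆ T ∪ (S ∪ ⁅ e ⁆)
    T∪S∪e⊆T∪[S∪e] = ∪-least (∪-mono id ∪-inl) (∪-inr ∘ ∪-inr)

  swap-inequality : ∀ {S A Y e} → S ⊆ A → S ⊆ Y → Indep Y → GreedyChoice S e →
                    Y ⊆ A ⊎ ∃[ o ] (o ∈ Y × Y ⊆ A ∪ ⁅ o ⁆) →
                    (f (T ∪ Y) + f (T ∪ S)) ≤ (f (T ∪ A) + f (T ∪ (S ∪ ⁅ e ⁆)))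
  swap-inequality _ _ _ _ (inj₁ Y⊆A) = swap-inequality-covered (∪-inr ∘ Y⊆A)
  swap-inequality {A = A} S⊆A S⊆Y iY greedy (inj₂ (o , o∈Y , Y⊆A∪o)) with o ∈? T ∪ A
  ... | yes o∈T∪A = swap-inequality-covered (∪-least ∪-inr (x∈p⇒⁅x⁆⊆p o∈T∪A) ∘ Y⊆A∪o)
  ... | no o∉T∪A  = swap-inequality-single S⊆A o∉T∪A Y⊆A∪o
    (greedy o (o∉T∪A ∘ ∪-inr ∘ S⊆A) (indep-down (∪-least S⊆Y (x∈p⇒⁅x⁆⊆p o∈Y)) iY))

  bound-step : ∀ {c S} e → Indep (S ∪ ⁅ e ⁆) → GreedyChoice S e →
               ExtensionBound c (S ∪ ⁅ e ⁆) → ExtensionBound c S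
  bound-step e iS∪e greedy bound Y S⊆Y iY with augment iS∪e iY
  ... | A , S∪e⊆A , A⊆S∪e∪Y , iA , ∣Y∣≤∣A∣ =
    ≤-trans (swap-inequality (S∪e⊆A ∘ ∪-inl) S⊆Y iY greedy
               (misses-at-most-one e (∪-least (∪-mono S⊆Y id) ∪-inl ∘ A⊆S∪e∪Y) ∣Y∣≤∣A∣))
            (bound A S∪e⊆A iA)

  bound-reach : ∀ {c S} → PhaseReach T S → ExtensionBound c S → ExtensionBound c ∅
  bound-reach start                       bound = bound
  bound-reach (step e reach _ iS∪e greedy) bound = bound-reach reach (bound-step e iS∪e greedy bound)

  bound-basis : ∀ {S} → IsBasis S → ExtensionBound (f (T ∪ S) + f (T ∪ S)) S
  bound-basis (_ , maximal) Y S⊆Y iY = +-mono-≤ _ (mono (∪-mono id (maximal Y S⊆Y iY)))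

  phase-approx : ∀ {S O} → PhaseOutput T S → Indep O → (f O + f T) ≤ (f (S ∪ T) + f (S ∪ T))
  phase-approx {S} {O} (reach , basis) iO = begin
    f O + f T                     ≤⟨ +-mono₂-≤ (mono ∪-inr) (mono ∪-inl) ⟩
    f (T ∪ O) + f (T ∪ ∅)         ≤⟨ bound-reach reach (bound-basis basis) O ⊥⊆ iO ⟩
    f (T ∪ S) + f (T ∪ S)         ≡⟨ cong (λ U → f U + f U) (∪-comm T S) ⟩
    f (S ∪ T) + f (S ∪ T)         ∎
    where open ≤-Reasoning

module GreedyRun (R : OrderedCommRing) {n : ℕ} (M : Matroid n)
                 (f : Subset n → OrderedCommRing.Carrier R)
                 (mono : Monotone R f) (submod : Submodular R f) where
  open OrderedCommRing R
  open OrderedCommRingProperties R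
  open Matroid M
  open Greedy R M f
  open GreedyPhase R M f mono submod using (phase-approx)

  run-approx : ∀ {k Ss} → Run k Ss → 0# ≤ f ∅ →
               All Indep Ss × (∀ O → Indep O → Approx (2 ℕ.^ k) (f O) (f (⋃ Ss)))
  run-approx run-zero 0≤f∅ = [] , λ _ _ → approx-1 0≤f∅
  run-approx (run-suc {k} {Ss} run output) 0≤f∅ =
    let indep , approx = run-approx run 0≤f∅ in
    proj₁ (proj₂ output) ∷ indep ,
    λ O iO → approx-2* (2 ℕ.^ k) (approx O iO) (phase-approx (⋃ Ss) output iO)

theorem3 : (R : OrderedCommRing) → let open OrderedCommRing R in
           {n : ℕ} (M : Matroid n) (ℓ : ℕ) → ℓ ≥ 1 →
           (f : Subset n → Carrier) →
           (∀ A → 0# ≤ f A) → Monotone R f → Submodular R f → f ∅ ≈ 0# →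
           (Ss : Vec (Subset n) ℓ) → Greedy.Run R M f ℓ Ss →
           All (Matroid.Indep M) Ss ×
           (∀ S → Matroid.Indep M S →
              ((fromℕ (2 Data.Nat.^ ℓ) - 1#) * f S)
                ≤ (fromℕ (2 Data.Nat.^ ℓ) * f (Greedy.⋃ R M f Ss)))
theorem3 R M ℓ _ f nonneg mono submod _ Ss run = GreedyRun.run-approx R M f mono submod run (nonneg ∅)
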